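{- For every integer $d\ge 1$, the generating function $g^d(x)=\sum_{n=0}^{\infty}|P_n^d|\,x^n$ satisfies, as formal power series, $$g^d(x)=\frac{(1+x)^{d-1}}{(1-x)^{d+1}}.$$
   Context: For integers $d\ge 1$ and $n\ge 0$, let $e_1,\dots,e_d$ be the standard unit vectors of $\mathbb{Z}^d$ and let $P_n^d=\{X_1+X_2+\cdots+X_n : X_i\in\{\pm e_1,\dots,\pm e_d\}\text{ for } i=1,\dots,n\}\subseteq\mathbb{Z}^d$ be the set of possible positions of a nearest-neighbour walk in $\mathbb{Z}^d$ starting at the origin after exactly $n$ unit steps (so $P_0^d=\{0\}$). $|P_n^d|$ denotes its cardinality. -}

module Defs where

open import Data.Nat as ℕ using (ℕ; zero; suc; _∸_)
open import Data.Integer as ℤ using (ℤ; +_; -_; 0ℤ; 1ℤ)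
open import Data.Fin as Fin using (Fin)
open import Data.Bool using (Bool; true; false; if_then_else_)
open import Data.Product using (_×_; _,_)
open import Data.List as List using (List; []; _∷_; concatMap; allFin; deduplicate; length; upTo; foldr)
open import Data.Vec as Vec using (Vec)
open import Data.Vec.Properties using (≡-dec)
open import Relation.Nullary.Decidable using (⌊_⌋)
open import Relation.Binary.PropositionalEquality using (_≡_)

-- A unit step in ℤ^d: a direction i and a sign (true = +e_i, false = -e_i).
Step : ℕ → Set
Step d = Fin d × Bool

allSteps : (d : ℕ) → List (Step d)
allSteps d = concatMap (λ i → (i , true) ∷ (i , false) ∷ []) (allFin d)

allWalks : (d n : ℕ) → List (Vec (Step d) n)
allWalks d zero    = Vec.[] ∷ []
allWalks d (suc n) = concatMap (λ s → List.map (s Vec.∷_) (allWalks d n)) (allSteps d)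

stepVec : {d : ℕ} → Step d → Vec ℤ d
stepVec (i , b) = Vec.tabulate (λ j → if ⌊ i Fin.≟ j ⌋ then (if b then 1ℤ else - 1ℤ) else 0ℤ)

position : {d n : ℕ} → Vec (Step d) n → Vec ℤ d
position {d} = Vec.foldr _ (λ s acc → Vec.zipWith ℤ._+_ (stepVec s) acc) (Vec.replicate d 0ℤ)

P : (d n : ℕ) → List (Vec ℤ d)
P d n = deduplicate (≡-dec ℤ._≟_) (List.map position (allWalks d n))

cardP : (d n : ℕ) → ℕ
cardP d n = length (P d n)

FPS : Set
FPS = ℕ → ℤ

sumℤ : List ℤ → ℤ
sumℤ = foldr ℤ._+_ 0ℤ

_⊛_ : FPS → FPS → FPS
(f ⊛ g) n = sumℤ (List.map (λ k → f k ℤ.* g (n ∸ k)) (upTo (suc n)))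

oneS : FPS
oneS zero    = 1ℤ
oneS (suc _) = 0ℤ

_^S_ : FPS → ℕ → FPS
f ^S zero  = oneS
f ^S suc k = f ⊛ (f ^S k)

onePlusX : FPS
onePlusX zero          = 1ℤ
onePlusX (suc zero)    = 1ℤ
onePlusX (suc (suc _)) = 0ℤ

oneMinusX : FPS
oneMinusX zero          = 1ℤ
oneMinusX (suc zero)    = - 1ℤ
oneMinusX (suc (suc _)) = 0ℤ

g : ℕ → FPS
g d n = + cardP d n

-- For d ≥ 1 a point v ∈ ℤ^d is the endpoint of an n-step walk iff ‖v‖₁ ≤ n and n − ‖v‖₁ is even:
-- every step changes ‖v‖₁ by exactly one, and two surplus steps can be spent going back and
-- forth along e₁. Let A_d count the points of ℤ^d with this property. Sorting the points of
-- ℤ^(d+1) by the absolute value of their first coordinate gives A_(d+1) = S · A_d with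
-- S = Σ_(x ∈ ℤ) t^∣x∣ = (1 + t)/(1 − t), while A_0 = 1/(1 − t²). Hence
-- (1 − t) A_(d+1) = (1 + t) A_d and (1 + t)(1 − t) A_0 = 1, which force
-- A_d = (1 + t)^(d−1)/(1 − t)^(d+1). Multiplication by 1 + c t is treated as an operator on
-- coefficient sequences commuting with ⊛ and with itself; that is all the power-series
-- algebra needed.
module Submission where

open import Defs
open import Relation.Binary.PropositionalEquality
  using (_≡_; refl; sym; trans; cong; cong₂; subst; _≗_; module ≡-Reasoning)

module PowerSeries where
  open import Data.Integer using (ℤ; 0ℤ; 1ℤ; -1ℤ; _+_; _*_)
  open import Data.Integer.Properties
    using (+-assoc; +-identityˡ; +-identityʳ; *-identityˡ; *-identityʳ; *-zeroʳ)
  open import Data.Integer.Tactic.RingSolver using (solve-∀)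
  open import Data.List using (applyUpTo)
  open import Data.List.Properties using (map-applyUpTo)
  open import Data.Nat as ℕ using (ℕ; zero; suc; _∸_; _<_; s≤s; z≤n)
  open import Data.Nat.Properties using (n∸n≡0; +-∸-assoc; +-comm)
  open import Function using (_∘_)
  open ≡-Reasoning

  ∑ : ℕ → (ℕ → ℤ) → ℤ
  ∑ zero    F = 0ℤ
  ∑ (suc n) F = F 0 + ∑ n (F ∘ suc)

  ∑-cong : ∀ n {F G : ℕ → ℤ} → (∀ {k} → k < n → F k ≡ G k) → ∑ n F ≡ ∑ n G
  ∑-cong zero    F≡G = refl
  ∑-cong (suc n) F≡G = cong₂ _+_ (F≡G (s≤s z≤n)) (∑-cong n (F≡G ∘ s≤s))

  ∑-0 : ∀ n → ∑ n (λ _ → 0ℤ) ≡ 0ℤ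
  ∑-0 zero    = refl
  ∑-0 (suc n) = cong (0ℤ +_) (∑-0 n)

  ∑-sucʳ : ∀ n (F : ℕ → ℤ) → ∑ (suc n) F ≡ ∑ n F + F n
  ∑-sucʳ zero    F = trans (+-identityʳ (F 0)) (sym (+-identityˡ (F 0)))
  ∑-sucʳ (suc n) F = trans (cong (F 0 +_) (∑-sucʳ n (F ∘ suc))) (sym (+-assoc (F 0) _ _))

  ∑-linear : ∀ n (F G : ℕ → ℤ) c → ∑ n (λ k → F k + c * G k) ≡ ∑ n F + c * ∑ n G
  ∑-linear zero    F G c = sym (trans (+-identityˡ _) (*-zeroʳ c))
  ∑-linear (suc n) F G c =
    trans (cong (F 0 + c * G 0 +_) (∑-linear n (F ∘ suc) (G ∘ suc) c)) (interchange (F 0) (G 0) _ _ c)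
    where
    interchange : ∀ a b s t c → (a + c * b) + (s + c * t) ≡ (a + s) + c * (b + t)
    interchange = solve-∀

  ⊛-∑ : ∀ f a n → (f ⊛ a) n ≡ ∑ (suc n) (λ k → f k * a (n ∸ k))
  ⊛-∑ f a n = trans (cong sumℤ (map-applyUpTo (λ k → k) F (suc n))) (sumℤ-applyUpTo (suc n) F)
    where
    F : ℕ → ℤ
    F k = f k * a (n ∸ k)
    sumℤ-applyUpTo : ∀ m (G : ℕ → ℤ) → sumℤ (applyUpTo G m) ≡ ∑ m G
    sumℤ-applyUpTo zero    G = refl
    sumℤ-applyUpTo (suc m) G = cong (G 0 +_) (sumℤ-applyUpTo m (G ∘ suc))

  ⊛-∑ʳ : ∀ f a n → (f ⊛ a) (suc n) ≡ ∑ (suc n) (λ k → f k * a (suc n ∸ k)) + f (suc n) * a 0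
  ⊛-∑ʳ f a n = begin
      (f ⊛ a) (suc n)
    ≡⟨ ⊛-∑ f a (suc n) ⟩
      ∑ (suc (suc n)) F
    ≡⟨ ∑-sucʳ (suc n) F ⟩
      ∑ (suc n) F + f (suc n) * a (n ∸ n)
    ≡⟨ cong (λ m → ∑ (suc n) F + f (suc n) * a m) (n∸n≡0 n) ⟩
      ∑ (suc n) F + f (suc n) * a 0 ∎
    where
    F : ℕ → ℤ
    F k = f k * a (suc n ∸ k)

  ⊛-congˡ : ∀ f {a b} → a ≗ b → (f ⊛ a) ≗ (f ⊛ b)
  ⊛-congˡ f {a} {b} a≗b n = begin
    (f ⊛ a) n                            ≡⟨ ⊛-∑ f a n ⟩
    ∑ (suc n) (λ k → f k * a (n ∸ k))    ≡⟨ ∑-cong (suc n) (λ {k} _ → cong (f k *_) (a≗b (n ∸ k))) ⟩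
    ∑ (suc n) (λ k → f k * b (n ∸ k))    ≡⟨ ⊛-∑ f b n ⟨
    (f ⊛ b) n                            ∎

  ⊛-congʳ : ∀ {f h} → f ≗ h → ∀ a → (f ⊛ a) ≗ (h ⊛ a)
  ⊛-congʳ {f} {h} f≗h a n = begin
    (f ⊛ a) n                            ≡⟨ ⊛-∑ f a n ⟩
    ∑ (suc n) (λ k → f k * a (n ∸ k))    ≡⟨ ∑-cong (suc n) (λ {k} _ → cong (_* a (n ∸ k)) (f≗h k)) ⟩
    ∑ (suc n) (λ k → h k * a (n ∸ k))    ≡⟨ ⊛-∑ h a n ⟨
    (h ⊛ a) n                            ∎

  ⊛-identityˡ : ∀ f → (oneS ⊛ f) ≗ f
  ⊛-identityˡ f n = begin
    (oneS ⊛ f) n               ≡⟨ ⊛-∑ oneS f n ⟩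
    1ℤ * f n + ∑ n (λ _ → 0ℤ)  ≡⟨ cong (1ℤ * f n +_) (∑-0 n) ⟩
    1ℤ * f n + 0ℤ              ≡⟨ +-identityʳ (1ℤ * f n) ⟩
    1ℤ * f n                   ≡⟨ *-identityˡ (f n) ⟩
    f n                        ∎

  ⊛-identityʳ : ∀ f → (f ⊛ oneS) ≗ f
  ⊛-identityʳ f zero    = trans (+-identityʳ (f 0 * 1ℤ)) (*-identityʳ (f 0))
  ⊛-identityʳ f (suc n) = begin
    (f ⊛ oneS) (suc n)                  ≡⟨ ⊛-∑ f oneS (suc n) ⟩
    f 0 * 0ℤ + ∑ (suc n) (λ k → f (suc k) * oneS (n ∸ k))
                                        ≡⟨ cong₂ _+_ (*-zeroʳ (f 0)) (sym (⊛-∑ (f ∘ suc) oneS n)) ⟩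
    0ℤ + ((f ∘ suc) ⊛ oneS) n           ≡⟨ +-identityˡ _ ⟩
    ((f ∘ suc) ⊛ oneS) n                ≡⟨ ⊛-identityʳ (f ∘ suc) n ⟩
    f (suc n)                           ∎

  infixr 7 [1+_x]·_ [1+_x]^_·_

  [1+_x]·_ : ℤ → FPS → FPS
  ([1+ c x]· f) zero    = f zero
  ([1+ c x]· f) (suc n) = f (suc n) + c * f n

  [1+x]·-cong : ∀ c {f h} → f ≗ h → [1+ c x]· f ≗ [1+ c x]· h
  [1+x]·-cong c f≗h zero    = f≗h 0
  [1+x]·-cong c f≗h (suc n) = cong₂ (λ u v → u + c * v) (f≗h (suc n)) (f≗h n)

  [1+x]·-comm : ∀ c c′ f → [1+ c x]· [1+ c′ x]· f ≗ [1+ c′ x]· [1+ c x]· f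
  [1+x]·-comm c c′ f zero          = refl
  [1+x]·-comm c c′ f (suc zero)    = swap (f 1) (f 0) c c′
    where
    swap : ∀ u v c c′ → u + c′ * v + c * v ≡ u + c * v + c′ * v
    swap = solve-∀
  [1+x]·-comm c c′ f (suc (suc n)) = swap (f (suc (suc n))) (f (suc n)) (f n) c c′
    where
    swap : ∀ u v w c c′ → u + c′ * v + c * (v + c′ * w) ≡ u + c * v + c′ * (v + c * w)
    swap = solve-∀

  [1+x]·-⊛ : ∀ c f a → (([1+ c x]· f) ⊛ a) ≗ [1+ c x]· (f ⊛ a)
  [1+x]·-⊛ c f a zero    = refl
  [1+x]·-⊛ c f a (suc n) = begin
      (([1+ c x]· f) ⊛ a) (suc n)
    ≡⟨ ⊛-∑ ([1+ c x]· f) a (suc n) ⟩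
      f 0 * a (suc n) + ∑ (suc n) (λ k → (f (suc k) + c * f k) * a (n ∸ k))
    ≡⟨ cong (f 0 * a (suc n) +_)
            (trans (∑-cong (suc n) (λ {k} _ → distrib (f (suc k)) (f k) (a (n ∸ k)) c)) (∑-linear (suc n) F G c)) ⟩
      f 0 * a (suc n) + (∑ (suc n) F + c * ∑ (suc n) G)
    ≡⟨ +-assoc (f 0 * a (suc n)) (∑ (suc n) F) (c * ∑ (suc n) G) ⟨
      (f 0 * a (suc n) + ∑ (suc n) F) + c * ∑ (suc n) G
    ≡⟨ cong₂ (λ s t → s + c * t) (⊛-∑ f a (suc n)) (⊛-∑ f a n) ⟨
      ([1+ c x]· (f ⊛ a)) (suc n) ∎
    where
    F G : ℕ → ℤ
    F k = f (suc k) * a (n ∸ k)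
    G k = f k * a (n ∸ k)
    distrib : ∀ u v w c → (u + c * v) * w ≡ u * w + c * (v * w)
    distrib = solve-∀

  ⊛-[1+x]· : ∀ c f a → (f ⊛ ([1+ c x]· a)) ≗ [1+ c x]· (f ⊛ a)
  ⊛-[1+x]· c f a zero    = refl
  ⊛-[1+x]· c f a (suc n) = begin
      (f ⊛ ([1+ c x]· a)) (suc n)
    ≡⟨ ⊛-∑ʳ f ([1+ c x]· a) n ⟩
      ∑ (suc n) (λ k → f k * ([1+ c x]· a) (suc n ∸ k)) + f (suc n) * a 0
    ≡⟨ cong (_+ f (suc n) * a 0) (trans (∑-cong (suc n) distrib) (∑-linear (suc n) F G c)) ⟩
      (∑ (suc n) F + c * ∑ (suc n) G) + f (suc n) * a 0
    ≡⟨ +-rightComm (∑ (suc n) F) (c * ∑ (suc n) G) (f (suc n) * a 0) ⟩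
      (∑ (suc n) F + f (suc n) * a 0) + c * ∑ (suc n) G
    ≡⟨ cong₂ (λ s t → s + c * t) (⊛-∑ʳ f a n) (⊛-∑ f a n) ⟨
      ([1+ c x]· (f ⊛ a)) (suc n) ∎
    where
    F G : ℕ → ℤ
    F k = f k * a (suc n ∸ k)
    G k = f k * a (n ∸ k)
    +-rightComm : ∀ r s t → (r + s) + t ≡ (r + t) + s
    +-rightComm = solve-∀
    distrib : ∀ {k} → k < suc n → f k * ([1+ c x]· a) (suc n ∸ k) ≡ F k + c * G k
    distrib {k} (s≤s k≤n) rewrite +-∸-assoc 1 k≤n = *-distrib (f k) (a (suc (n ∸ k))) (a (n ∸ k)) c
      where
      *-distrib : ∀ u v w c → u * (v + c * w) ≡ u * v + c * (u * w)
      *-distrib = solve-∀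

  [1+_x]^_·_ : ℤ → ℕ → FPS → FPS
  [1+ c x]^ zero  · f = f
  [1+ c x]^ suc k · f = [1+ c x]· [1+ c x]^ k · f

  [1+x]^-cong : ∀ c k {f h} → f ≗ h → [1+ c x]^ k · f ≗ [1+ c x]^ k · h
  [1+x]^-cong c zero    f≗h = f≗h
  [1+x]^-cong c (suc k) f≗h = [1+x]·-cong c ([1+x]^-cong c k f≗h)

  [1+x]^-comm : ∀ c c′ k f → [1+ c x]^ k · [1+ c′ x]· f ≗ [1+ c′ x]· [1+ c x]^ k · f
  [1+x]^-comm c c′ zero    f n = refl
  [1+x]^-comm c c′ (suc k) f n = begin
    ([1+ c x]· [1+ c x]^ k · [1+ c′ x]· f) n   ≡⟨ [1+x]·-cong c ([1+x]^-comm c c′ k f) n ⟩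
    ([1+ c x]· [1+ c′ x]· [1+ c x]^ k · f) n   ≡⟨ [1+x]·-comm c c′ ([1+ c x]^ k · f) n ⟩
    ([1+ c′ x]· [1+ c x]· [1+ c x]^ k · f) n   ∎

  linear-⊛ : ∀ {c u} → u ≗ [1+ c x]· oneS → ∀ a → (u ⊛ a) ≗ [1+ c x]· a
  linear-⊛ {c} {u} u≗1+cx a n = begin
    (u ⊛ a) n                    ≡⟨ ⊛-congʳ u≗1+cx a n ⟩
    (([1+ c x]· oneS) ⊛ a) n     ≡⟨ [1+x]·-⊛ c oneS a n ⟩
    ([1+ c x]· (oneS ⊛ a)) n     ≡⟨ [1+x]·-cong c (⊛-identityˡ a) n ⟩
    ([1+ c x]· a) n              ∎

  ⊛-^S-linear : ∀ {c u} → u ≗ [1+ c x]· oneS → ∀ k f → (f ⊛ (u ^S k)) ≗ [1+ c x]^ k · f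
  ⊛-^S-linear u≗1+cx zero f = ⊛-identityʳ f
  ⊛-^S-linear {c} {u} u≗1+cx (suc k) f n = begin
    (f ⊛ (u ⊛ (u ^S k))) n          ≡⟨ ⊛-congˡ f (linear-⊛ u≗1+cx (u ^S k)) n ⟩
    (f ⊛ ([1+ c x]· (u ^S k))) n    ≡⟨ ⊛-[1+x]· c f (u ^S k) n ⟩
    ([1+ c x]· (f ⊛ (u ^S k))) n    ≡⟨ [1+x]·-cong c (⊛-^S-linear u≗1+cx k f) n ⟩
    ([1+ c x]^ suc k · f) n         ∎

  onePlusX-linear : onePlusX ≗ [1+ 1ℤ x]· oneS
  onePlusX-linear zero          = refl
  onePlusX-linear (suc zero)    = refl
  onePlusX-linear (suc (suc n)) = refl

  oneMinusX-linear : oneMinusX ≗ [1+ -1ℤ x]· oneS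
  oneMinusX-linear zero          = refl
  oneMinusX-linear (suc zero)    = refl
  oneMinusX-linear (suc (suc n)) = refl

  module _ (A : ℕ → FPS) (recurrence : ∀ d → [1+ -1ℤ x]· A (suc d) ≗ [1+ 1ℤ x]· A d) where

    [1-x]^-recurrence : ∀ d → [1+ -1ℤ x]^ suc d · A d ≗ [1+ 1ℤ x]^ d · [1+ -1ℤ x]· A 0
    [1-x]^-recurrence zero    n = refl
    [1-x]^-recurrence (suc d) n = begin
      ([1+ -1ℤ x]^ suc (suc d) · A (suc d)) n          ≡⟨ [1+x]^-comm -1ℤ -1ℤ (suc d) (A (suc d)) n ⟨
      ([1+ -1ℤ x]^ suc d · [1+ -1ℤ x]· A (suc d)) n    ≡⟨ [1+x]^-cong -1ℤ (suc d) (recurrence d) n ⟩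
      ([1+ -1ℤ x]^ suc d · [1+ 1ℤ x]· A d) n           ≡⟨ [1+x]^-comm -1ℤ 1ℤ (suc d) (A d) n ⟩
      ([1+ 1ℤ x]· [1+ -1ℤ x]^ suc d · A d) n           ≡⟨ [1+x]·-cong 1ℤ ([1-x]^-recurrence d) n ⟩
      ([1+ 1ℤ x]^ suc d · [1+ -1ℤ x]· A 0) n           ∎

    solve-recurrence : [1+ 1ℤ x]· [1+ -1ℤ x]· A 0 ≗ oneS →
      ∀ d → 1 ℕ.≤ d → (A d ⊛ (oneMinusX ^S (d ℕ.+ 1))) ≗ (onePlusX ^S (d ∸ 1))
    solve-recurrence initial (suc e) _ n = begin
        (A (suc e) ⊛ (oneMinusX ^S (suc e ℕ.+ 1))) n
      ≡⟨ ⊛-^S-linear oneMinusX-linear (suc e ℕ.+ 1) (A (suc e)) n ⟩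
        ([1+ -1ℤ x]^ (suc e ℕ.+ 1) · A (suc e)) n
      ≡⟨ cong (λ k → ([1+ -1ℤ x]^ k · A (suc e)) n) (+-comm (suc e) 1) ⟩
        ([1+ -1ℤ x]^ suc (suc e) · A (suc e)) n
      ≡⟨ [1-x]^-recurrence (suc e) n ⟩
        ([1+ 1ℤ x]^ suc e · [1+ -1ℤ x]· A 0) n
      ≡⟨ [1+x]^-comm 1ℤ 1ℤ e ([1+ -1ℤ x]· A 0) n ⟨
        ([1+ 1ℤ x]^ e · [1+ 1ℤ x]· [1+ -1ℤ x]· A 0) n
      ≡⟨ [1+x]^-cong 1ℤ e initial n ⟩
        ([1+ 1ℤ x]^ e · oneS) n
      ≡⟨ ⊛-^S-linear onePlusX-linear e oneS n ⟨
        (oneS ⊛ (onePlusX ^S e)) n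
      ≡⟨ ⊛-identityˡ (onePlusX ^S e) n ⟩
        (onePlusX ^S e) n ∎

module LatticePoints where

  open PowerSeries
  open import Data.Bool using (Bool; true; false; if_then_else_)
  open import Data.Empty using (⊥-elim)
  open import Data.Fin as Fin using (Fin)
  open import Data.Integer as ℤ using (ℤ; +_; -[1+_]; 0ℤ; 1ℤ; -1ℤ; ∣_∣)
  import Data.Integer.Properties as ℤₚ
  open import Data.Integer.Tactic.RingSolver using (solve-∀)
  open import Data.List as List
    using (List; []; _∷_; _++_; length; concatMap; cartesianProductWith; upTo)
  open import Data.List.Membership.Propositional using (_∈_; find; lose)
  open import Data.List.Membership.Propositional.Properties
    using (∈-map⁺; ∈-map⁻; ∈-concatMap⁺; ∈-concatMap⁻; ∈-cartesianProductWith⁺; ∈-cartesianProductWith⁻;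
           ∈-allFin; ∈-upTo⁺; ∈-upTo⁻; deduplicate-∈⇔)
  open import Data.List.Membership.Propositional.Properties.WithK using (unique∧set⇒bag)
  open import Data.List.Properties using (length-++; length-map; map-cong)
  open import Data.List.Relation.Binary.BagAndSetEquality using (∼bag⇒↭)
  open import Data.List.Relation.Binary.Permutation.Propositional.Properties using (↭-length)
  import Data.List.Relation.Unary.All as All
  import Data.List.Relation.Unary.All.Properties as All
  import Data.List.Relation.Unary.AllPairs as AllPairs
  import Data.List.Relation.Unary.AllPairs.Properties as AllPairs
  open import Data.List.Relation.Unary.Any using (here; there)
  open import Data.List.Relation.Unary.Unique.Propositional using (Unique)
  import Data.List.Relation.Unary.Unique.Propositional.Properties as Unique
  import Data.List.Relation.Unary.Unique.DecPropositional.Properties as UniqueDec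
  open import Data.Nat using (ℕ; zero; suc; _+_; _*_; _∸_; _≤_; s≤s)
  import Data.Nat.Properties as ℕₚ
  open import Data.Product using (Σ-syntax; ∃-syntax; _×_; _,_)
  open import Data.Sum using (_⊎_; inj₁; inj₂)
  open import Data.Vec as Vec using (Vec; []; _∷_; replicate; zipWith)
  open import Data.Vec.Properties using (∷-injective; ≡-dec; tabulate-cong)
  open import Function using (_∘_)
  open import Function.Bundles using (_⇔_; mk⇔; Equivalence)
  open import Relation.Nullary using (¬_)
  open import Relation.Nullary.Decidable using (⌊⌋-map′)
  open ≡-Reasoning

  concatMap-unique : ∀ {A B : Set} {f : A → List B} {xs} → Unique xs → (∀ x → Unique (f x)) →
    (∀ {x y v} → v ∈ f x → v ∈ f y → x ≡ y) → Unique (concatMap f xs)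
  concatMap-unique {f = f} {xs} xs! f! separated = Unique.concat⁺
    (All.map⁺ (All.universal f! xs))
    (AllPairs.map⁺ (AllPairs.map (λ x≢y {_} (v∈fx , v∈fy) → x≢y (separated v∈fx v∈fy)) xs!))

  length-unique-≡ : ∀ {A : Set} {xs ys : List A} → Unique xs → Unique ys →
    (∀ {x} → x ∈ xs ⇔ x ∈ ys) → length xs ≡ length ys
  length-unique-≡ xs! ys! xs≈ys = ↭-length (∼bag⇒↭ (unique∧set⇒bag xs! ys! xs≈ys))

  length-cartesianProductWith : ∀ {A B C : Set} (f : A → B → C) xs ys →
    length (cartesianProductWith f xs ys) ≡ length xs * length ys
  length-cartesianProductWith f []       ys = refl
  length-cartesianProductWith f (x ∷ xs) ys = begin
      length (List.map (f x) ys ++ cartesianProductWith f xs ys)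
    ≡⟨ length-++ (List.map (f x) ys) ⟩
      length (List.map (f x) ys) + length (cartesianProductWith f xs ys)
    ≡⟨ cong₂ _+_ (length-map (f x) ys) (length-cartesianProductWith f xs ys) ⟩
      length ys + length xs * length ys ∎

  +length-concatMap : ∀ {A B : Set} (f : A → List B) xs →
    + length (concatMap f xs) ≡ sumℤ (List.map (λ x → + length (f x)) xs)
  +length-concatMap f []       = refl
  +length-concatMap f (x ∷ xs) = begin
      + length (f x ++ concatMap f xs)
    ≡⟨ cong +_ (length-++ (f x)) ⟩
      + (length (f x) + length (concatMap f xs))
    ≡⟨ ℤₚ.pos-+ (length (f x)) (length (concatMap f xs)) ⟩
      + length (f x) ℤ.+ + length (concatMap f xs)
    ≡⟨ cong (λ t → + length (f x) ℤ.+ t) (+length-concatMap f xs) ⟩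
      sumℤ (List.map (λ x → + length (f x)) (x ∷ xs)) ∎

  ‖_‖₁ : ∀ {d} → Vec ℤ d → ℕ
  ‖ [] ‖₁    = 0
  ‖ x ∷ v ‖₁ = ∣ x ∣ + ‖ v ‖₁

  ‖0‖₁ : ∀ d → ‖ replicate d 0ℤ ‖₁ ≡ 0
  ‖0‖₁ zero    = refl
  ‖0‖₁ (suc d) = ‖0‖₁ d

  ‖‖₁≡0⇒0 : ∀ {d} (v : Vec ℤ d) → ‖ v ‖₁ ≡ 0 → v ≡ replicate d 0ℤ
  ‖‖₁≡0⇒0 []      _ = refl
  ‖‖₁≡0⇒0 (x ∷ v) e =
    cong₂ _∷_ (ℤₚ.∣i∣≡0⇒i≡0 (ℕₚ.m+n≡0⇒m≡0 ∣ x ∣ e)) (‖‖₁≡0⇒0 v (ℕₚ.m+n≡0⇒n≡0 ∣ x ∣ e))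

  infix 4 _≤₂_
  _≤₂_ : ℕ → ℕ → Set
  m ≤₂ n = ∃[ k ] m + (k + k) ≡ n

  sign : Bool → ℤ
  sign b = if b then 1ℤ else -1ℤ

  move : ∀ {d} → Step d → Vec ℤ d → Vec ℤ d
  move s v = zipWith ℤ._+_ (stepVec s) v

  move-zero : ∀ {d} b x (v : Vec ℤ d) → move (Fin.zero , b) (x ∷ v) ≡ (sign b ℤ.+ x) ∷ v
  move-zero b x v = cong (sign b ℤ.+ x ∷_) (0+v≡v v)
    where
    0+v≡v : ∀ {d} (v : Vec ℤ d) → zipWith ℤ._+_ (Vec.tabulate (λ _ → 0ℤ)) v ≡ v
    0+v≡v []      = refl
    0+v≡v (x ∷ v) = cong₂ _∷_ (ℤₚ.+-identityˡ x) (0+v≡v v)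

  move-suc : ∀ {d} (i : Fin d) b x (v : Vec ℤ d) → move (Fin.suc i , b) (x ∷ v) ≡ x ∷ move (i , b) v
  move-suc i b x v = begin
    zipWith ℤ._+_ (stepVec (Fin.suc i , b)) (x ∷ v)   ≡⟨ cong (λ u → zipWith ℤ._+_ u (x ∷ v)) stepVec-suc ⟩
    0ℤ ℤ.+ x ∷ move (i , b) v                          ≡⟨ cong (λ y → y ∷ move (i , b) v) (ℤₚ.+-identityˡ x) ⟩
    x ∷ move (i , b) v                                 ∎
    where
    stepVec-suc : stepVec (Fin.suc i , b) ≡ 0ℤ ∷ stepVec (i , b)
    stepVec-suc = cong (0ℤ ∷_) (tabulate-cong λ j →
      cong (λ t → if t then sign b else 0ℤ) (⌊⌋-map′ _ _ (i Fin.≟ j)))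

  Adjacent : ℕ → ℕ → Set
  Adjacent m n = m ≡ suc n ⊎ suc m ≡ n

  adjacent-+ˡ : ∀ a {m n} → Adjacent m n → Adjacent (a + m) (a + n)
  adjacent-+ˡ a {n = n} (inj₁ refl) = inj₁ (ℕₚ.+-suc a n)
  adjacent-+ˡ a {m = m} (inj₂ refl) = inj₂ (sym (ℕₚ.+-suc a m))

  adjacent-+ʳ : ∀ a {m n} → Adjacent m n → Adjacent (m + a) (n + a)
  adjacent-+ʳ a (inj₁ refl) = inj₁ refl
  adjacent-+ʳ a (inj₂ refl) = inj₂ refl

  ∣sign+∣-adjacent : ∀ b x → Adjacent ∣ sign b ℤ.+ x ∣ ∣ x ∣
  ∣sign+∣-adjacent true  (+ n)          = inj₁ refl
  ∣sign+∣-adjacent true  -[1+ zero ]    = inj₂ refl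
  ∣sign+∣-adjacent true  -[1+ suc n ]   = inj₂ refl
  ∣sign+∣-adjacent false (+ zero)       = inj₁ refl
  ∣sign+∣-adjacent false (+ suc n)      = inj₂ refl
  ∣sign+∣-adjacent false -[1+ n ]       = inj₁ refl

  ‖move‖₁-adjacent : ∀ {d} (s : Step d) (v : Vec ℤ d) → Adjacent ‖ move s v ‖₁ ‖ v ‖₁
  ‖move‖₁-adjacent (Fin.zero , b) (x ∷ v) =
    subst (λ u → Adjacent ‖ u ‖₁ (∣ x ∣ + ‖ v ‖₁)) (sym (move-zero b x v))
      (adjacent-+ʳ ‖ v ‖₁ (∣sign+∣-adjacent b x))
  ‖move‖₁-adjacent (Fin.suc i , b) (x ∷ v) =
    subst (λ u → Adjacent ‖ u ‖₁ (∣ x ∣ + ‖ v ‖₁)) (sym (move-suc i b x v))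
      (adjacent-+ˡ ∣ x ∣ (‖move‖₁-adjacent (i , b) v))

  +-double-suc : ∀ m k → m + (suc k + suc k) ≡ suc (suc (m + (k + k)))
  +-double-suc m k = begin
    m + suc (k + suc k)      ≡⟨ ℕₚ.+-suc m (k + suc k) ⟩
    suc (m + (k + suc k))    ≡⟨ cong (λ t → suc (m + t)) (ℕₚ.+-suc k k) ⟩
    suc (m + suc (k + k))    ≡⟨ cong suc (ℕₚ.+-suc m (k + k)) ⟩
    suc (suc (m + (k + k)))  ∎

  ≤₂-step : ∀ {m n} → m ≤₂ n → m ≤₂ suc (suc n)
  ≤₂-step {m} (k , e) = suc k , trans (+-double-suc m k) (cong (suc ∘ suc) e)

  adjacent-≤₂ : ∀ {m m′ n} → Adjacent m m′ → m′ ≤₂ n → m ≤₂ suc n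
  adjacent-≤₂     (inj₁ refl) (k , e) = k , cong suc e
  adjacent-≤₂ {m} (inj₂ refl) (k , e) = suc k , trans (+-double-suc m k) (cong suc e)

  Reachable : ∀ d → ℕ → Vec ℤ d → Set
  Reachable d n v = Σ[ w ∈ Vec (Step d) n ] position w ≡ v

  ‖position‖₁-≤₂ : ∀ {d n} (w : Vec (Step d) n) → ‖ position w ‖₁ ≤₂ n
  ‖position‖₁-≤₂ {d} []    = 0 , trans (ℕₚ.+-identityʳ _) (‖0‖₁ d)
  ‖position‖₁-≤₂ (s ∷ w) = adjacent-≤₂ (‖move‖₁-adjacent s (position w)) (‖position‖₁-≤₂ w)

  ‖‖₁≡suc⇒move : ∀ {d m} (v : Vec ℤ d) → ‖ v ‖₁ ≡ suc m →
    ∃[ s ] ∃[ u ] v ≡ move s u × ‖ u ‖₁ ≡ m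
  ‖‖₁≡suc⇒move (+ zero ∷ v) e with ‖‖₁≡suc⇒move v e
  ... | (i , b) , u , refl , ‖u‖≡m = (Fin.suc i , b) , 0ℤ ∷ u , sym (move-suc i b 0ℤ u) , ‖u‖≡m
  ‖‖₁≡suc⇒move (+ suc j ∷ v) e =
    (Fin.zero , true) , + j ∷ v , sym (move-zero true (+ j) v) , ℕₚ.suc-injective e
  ‖‖₁≡suc⇒move (-[1+ zero ] ∷ v) e =
    (Fin.zero , false) , 0ℤ ∷ v , sym (move-zero false 0ℤ v) , ℕₚ.suc-injective e
  ‖‖₁≡suc⇒move (-[1+ suc j ] ∷ v) e =
    (Fin.zero , false) , -[1+ j ] ∷ v , sym (move-zero false -[1+ j ] v) , ℕₚ.suc-injective e

  -- The origin is one step away from -e₁, which needs d ≥ 1.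
  ≤₂-suc⇒move : ∀ {d n} (v : Vec ℤ (suc d)) → ‖ v ‖₁ ≤₂ suc n →
    ∃[ s ] ∃[ u ] v ≡ move s u × ‖ u ‖₁ ≤₂ n
  ≤₂-suc⇒move v (k , e) with ‖ v ‖₁ in ‖v‖≡
  ... | suc m with ‖‖₁≡suc⇒move v ‖v‖≡
  ...   | s , u , v≡move , ‖u‖≡m =
    s , u , v≡move , k , trans (cong (_+ (k + k)) ‖u‖≡m) (ℕₚ.suc-injective e)
  ≤₂-suc⇒move v (zero , ()) | zero
  ≤₂-suc⇒move {d} {n} v (suc k , e) | zero =
    (Fin.zero , true) , -1ℤ ∷ replicate d 0ℤ , v≡move , k , ‖-e₁‖₁+2k≡n
    where
    v≡move : v ≡ move (Fin.zero , true) (-1ℤ ∷ replicate d 0ℤ)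
    v≡move = trans (‖‖₁≡0⇒0 v ‖v‖≡) (sym (move-zero true -1ℤ (replicate d 0ℤ)))
    ‖-e₁‖₁+2k≡n : suc (‖ replicate d 0ℤ ‖₁ + (k + k)) ≡ n
    ‖-e₁‖₁+2k≡n = trans (cong (λ t → suc (t + (k + k))) (‖0‖₁ d))
                        (ℕₚ.suc-injective (trans (sym (cong suc (ℕₚ.+-suc k k))) e))

  ≤₂⇒reachable : ∀ {d} n (v : Vec ℤ (suc d)) → ‖ v ‖₁ ≤₂ n → Reachable (suc d) n v
  ≤₂⇒reachable zero    v (k , e) = [] , sym (‖‖₁≡0⇒0 v (ℕₚ.m+n≡0⇒m≡0 ‖ v ‖₁ e))
  ≤₂⇒reachable (suc n) v v≤₂ with ≤₂-suc⇒move v v≤₂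
  ... | s , u , refl , u≤₂ with ≤₂⇒reachable n u u≤₂
  ...   | w , refl = s ∷ w , refl

  step∈allSteps : ∀ {d} (s : Step d) → s ∈ allSteps d
  step∈allSteps (i , true)  = ∈-concatMap⁺ _ (lose (∈-allFin i) (here refl))
  step∈allSteps (i , false) = ∈-concatMap⁺ _ (lose (∈-allFin i) (there (here refl)))

  walk∈allWalks : ∀ {d n} (w : Vec (Step d) n) → w ∈ allWalks d n
  walk∈allWalks []      = here refl
  walk∈allWalks (s ∷ w) =
    ∈-concatMap⁺ _ (lose (step∈allSteps s) (∈-map⁺ (s ∷_) (walk∈allWalks w)))

  ∈P⇔reachable : ∀ {d n v} → v ∈ P d n ⇔ Reachable d n v
  ∈P⇔reachable {d} {n} = mk⇔ to from
    where
    to : ∀ {v} → v ∈ P d n → Reachable d n v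
    to v∈P with ∈-map⁻ position (Equivalence.from (deduplicate-∈⇔ (≡-dec ℤ._≟_)) v∈P)
    ... | w , _ , refl = w , refl
    from : ∀ {v} → Reachable d n v → v ∈ P d n
    from (w , refl) = Equivalence.to (deduplicate-∈⇔ (≡-dec ℤ._≟_)) (∈-map⁺ position (walk∈allWalks w))

  ∈P⇔≤₂ : ∀ {d n} {v : Vec ℤ (suc d)} → v ∈ P (suc d) n ⇔ ‖ v ‖₁ ≤₂ n
  ∈P⇔≤₂ {n = n} {v} = mk⇔
    (λ v∈P → let (w , w↦v) = Equivalence.to ∈P⇔reachable v∈P in
             subst (λ u → ‖ u ‖₁ ≤₂ n) w↦v (‖position‖₁-≤₂ w))
    (λ v≤₂n → Equivalence.from ∈P⇔reachable (≤₂⇒reachable n v v≤₂n))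

  +-≤₂⁺ : ∀ {m a n} → m ≤ n → a ≤₂ n ∸ m → m + a ≤₂ n
  +-≤₂⁺ {m} {a} {n} m≤n (k , e) = k , (begin
    m + a + (k + k)     ≡⟨ ℕₚ.+-assoc m a (k + k) ⟩
    m + (a + (k + k))   ≡⟨ cong (λ t → m + t) e ⟩
    m + (n ∸ m)         ≡⟨ ℕₚ.m+[n∸m]≡n m≤n ⟩
    n                   ∎)

  +-≤₂⁻ : ∀ {m a n} → m + a ≤₂ n → m ≤ n × a ≤₂ n ∸ m
  +-≤₂⁻ {m} {a} (k , refl) =
    ℕₚ.≤-trans (ℕₚ.m≤m+n m a) (ℕₚ.m≤m+n (m + a) (k + k)) ,
    k , sym (trans (cong (_∸ m) (ℕₚ.+-assoc m a (k + k))) (ℕₚ.m+n∸m≡n m (a + (k + k))))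

  0≤₂2+⇒0≤₂ : ∀ {n} → 0 ≤₂ suc (suc n) → 0 ≤₂ n
  0≤₂2+⇒0≤₂ (zero  , ())
  0≤₂2+⇒0≤₂ (suc k , e) = k , ℕₚ.suc-injective (trans (sym (ℕₚ.+-suc k k)) (ℕₚ.suc-injective e))

  0≰₂1 : ¬ (0 ≤₂ 1)
  0≰₂1 (zero  , ())
  0≰₂1 (suc k , e) = ℕₚ.1+n≢0 (trans (sym (ℕₚ.+-suc k k)) (ℕₚ.suc-injective e))

  ∣_∣⁻¹ : ℕ → List ℤ
  ∣ zero  ∣⁻¹ = 0ℤ ∷ []
  ∣ suc i ∣⁻¹ = + suc i ∷ -[1+ i ] ∷ []

  ∈∣∣⁻¹⇒ : ∀ {x k} → x ∈ ∣ k ∣⁻¹ → ∣ x ∣ ≡ k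
  ∈∣∣⁻¹⇒ {k = zero}  (here refl)         = refl
  ∈∣∣⁻¹⇒ {k = suc i} (here refl)         = refl
  ∈∣∣⁻¹⇒ {k = suc i} (there (here refl)) = refl

  x∈∣x∣⁻¹ : ∀ x → x ∈ ∣ ∣ x ∣ ∣⁻¹
  x∈∣x∣⁻¹ (+ zero)   = here refl
  x∈∣x∣⁻¹ (+ suc i)  = here refl
  x∈∣x∣⁻¹ -[1+ i ]   = there (here refl)

  ∣∣⁻¹-unique : ∀ k → Unique ∣ k ∣⁻¹
  ∣∣⁻¹-unique zero    = All.[] AllPairs.∷ AllPairs.[]
  ∣∣⁻¹-unique (suc i) = ((λ ()) All.∷ All.[]) AllPairs.∷ All.[] AllPairs.∷ AllPairs.[]

  -- A duplicate-free enumeration of {v ∈ ℤ^d : ‖v‖₁ ≤₂ n}, layered by the absolute value of v₁.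
  mutual
    ball : (d n : ℕ) → List (Vec ℤ d)
    ball zero    zero          = [] ∷ []
    ball zero    (suc zero)    = []
    ball zero    (suc (suc n)) = ball zero n
    ball (suc d) n             = concatMap (layer d n) (upTo (suc n))

    layer : (d n j : ℕ) → List (Vec ℤ (suc d))
    layer d n j = cartesianProductWith _∷_ ∣ j ∣⁻¹ (ball d (n ∸ j))

  ∈ball⇒≤₂ : ∀ {d} n {v : Vec ℤ d} → v ∈ ball d n → ‖ v ‖₁ ≤₂ n
  ∈ball⇒≤₂ {zero}  zero          (here refl) = 0 , refl
  ∈ball⇒≤₂ {zero}  (suc (suc n)) {[]} []∈ball = ≤₂-step {0} {n} (∈ball⇒≤₂ n []∈ball)
  ∈ball⇒≤₂ {suc d} n             v∈ball
    with j , j∈upTo , v∈layer ← find (∈-concatMap⁻ (layer d n) {upTo (suc n)} v∈ball)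
    with x , w , x∈ , w∈ball , refl ← ∈-cartesianProductWith⁻ _∷_ ∣ j ∣⁻¹ (ball d (n ∸ j)) v∈layer
    = subst (λ m → m + ‖ w ‖₁ ≤₂ n) (sym (∈∣∣⁻¹⇒ x∈))
        (+-≤₂⁺ (ℕₚ.≤-pred (∈-upTo⁻ j∈upTo)) (∈ball⇒≤₂ (n ∸ j) w∈ball))

  ≤₂⇒∈ball : ∀ {d} n (v : Vec ℤ d) → ‖ v ‖₁ ≤₂ n → v ∈ ball d n
  ≤₂⇒∈ball {zero}  zero          [] _       = here refl
  ≤₂⇒∈ball {zero}  (suc zero)    [] 0≤₂1    = ⊥-elim (0≰₂1 0≤₂1)
  ≤₂⇒∈ball {zero}  (suc (suc n)) [] 0≤₂2+n  = ≤₂⇒∈ball n [] (0≤₂2+⇒0≤₂ 0≤₂2+n)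
  ≤₂⇒∈ball {suc d} n (x ∷ w) x∷w≤₂n with ∣x∣≤n , w≤₂ ← +-≤₂⁻ {∣ x ∣} x∷w≤₂n =
    ∈-concatMap⁺ (layer d n) (lose (∈-upTo⁺ (s≤s ∣x∣≤n))
      (∈-cartesianProductWith⁺ _∷_ (x∈∣x∣⁻¹ x) (≤₂⇒∈ball (n ∸ ∣ x ∣) w w≤₂)))

  ∈ball⇔≤₂ : ∀ {d n} {v : Vec ℤ d} → v ∈ ball d n ⇔ ‖ v ‖₁ ≤₂ n
  ∈ball⇔≤₂ {n = n} {v} = mk⇔ (∈ball⇒≤₂ n) (≤₂⇒∈ball n v)

  ball-unique : ∀ d n → Unique (ball d n)
  ball-unique zero    zero          = All.[] AllPairs.∷ AllPairs.[]
  ball-unique zero    (suc zero)    = AllPairs.[]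
  ball-unique zero    (suc (suc n)) = ball-unique zero n
  ball-unique (suc d) n =
    concatMap-unique (Unique.upTo⁺ (suc n)) layer-unique layers-separated
    where
    layer-unique : ∀ j → Unique (layer d n j)
    layer-unique j = Unique.cartesianProductWith⁺ _∷_ ∷-injective (∣∣⁻¹-unique j) (ball-unique d (n ∸ j))
    ∣head∣ : ∀ {j v} → v ∈ layer d n j → ∣ Vec.head v ∣ ≡ j
    ∣head∣ {j} v∈layer
      with x , _ , x∈ , _ , refl ← ∈-cartesianProductWith⁻ _∷_ ∣ j ∣⁻¹ (ball d (n ∸ j)) v∈layer
      = ∈∣∣⁻¹⇒ x∈
    layers-separated : ∀ {i j v} → v ∈ layer d n i → v ∈ layer d n j → i ≡ j
    layers-separated v∈i v∈j = trans (sym (∣head∣ v∈i)) (∣head∣ v∈j)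

  count : ℕ → FPS
  count d n = + length (ball d n)

  absSeries : FPS
  absSeries k = + length ∣ k ∣⁻¹

  g≗count : ∀ d → 1 ≤ d → g d ≗ count d
  g≗count (suc d) _ n = cong +_ (length-unique-≡
    (UniqueDec.deduplicate-! (≡-dec ℤ._≟_) _) (ball-unique (suc d) n)
    (mk⇔ (Equivalence.from ∈ball⇔≤₂ ∘ Equivalence.to ∈P⇔≤₂)
         (Equivalence.from ∈P⇔≤₂ ∘ Equivalence.to ∈ball⇔≤₂)))

  count-suc : ∀ d → count (suc d) ≗ absSeries ⊛ count d
  count-suc d n =
    trans (+length-concatMap (layer d n) (upTo (suc n))) (cong sumℤ (map-cong +length-layer (upTo (suc n))))
    where
    +length-layer : ∀ j → + length (layer d n j) ≡ absSeries j ℤ.* count d (n ∸ j)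
    +length-layer j = trans (cong +_ (length-cartesianProductWith _∷_ ∣ j ∣⁻¹ (ball d (n ∸ j))))
                            (ℤₚ.pos-* (length ∣ j ∣⁻¹) (length (ball d (n ∸ j))))

  [1-x]absSeries : [1+ -1ℤ x]· absSeries ≗ [1+ 1ℤ x]· oneS
  [1-x]absSeries zero          = refl
  [1-x]absSeries (suc zero)    = refl
  [1-x]absSeries (suc (suc k)) = refl

  count-recurrence : ∀ d → [1+ -1ℤ x]· count (suc d) ≗ [1+ 1ℤ x]· count d
  count-recurrence d n = begin
    ([1+ -1ℤ x]· count (suc d)) n                ≡⟨ [1+x]·-cong -1ℤ (count-suc d) n ⟩
    ([1+ -1ℤ x]· (absSeries ⊛ count d)) n        ≡⟨ [1+x]·-⊛ -1ℤ absSeries (count d) n ⟨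
    (([1+ -1ℤ x]· absSeries) ⊛ count d) n        ≡⟨ ⊛-congʳ [1-x]absSeries (count d) n ⟩
    (([1+ 1ℤ x]· oneS) ⊛ count d) n              ≡⟨ [1+x]·-⊛ 1ℤ oneS (count d) n ⟩
    ([1+ 1ℤ x]· (oneS ⊛ count d)) n              ≡⟨ [1+x]·-cong 1ℤ (⊛-identityˡ (count d)) n ⟩
    ([1+ 1ℤ x]· count d) n                       ∎

  count-initial : [1+ 1ℤ x]· [1+ -1ℤ x]· count 0 ≗ oneS
  count-initial zero          = refl
  count-initial (suc zero)    = refl
  -- count 0 (2 + n) reduces to count 0 n.
  count-initial (suc (suc n)) = telescope (count 0 n) (count 0 (suc n))
    where
    telescope : ∀ a b → (a ℤ.+ -1ℤ ℤ.* b) ℤ.+ 1ℤ ℤ.* (b ℤ.+ -1ℤ ℤ.* a) ≡ 0ℤ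
    telescope = solve-∀

open PowerSeries using (⊛-congʳ; solve-recurrence)
open LatticePoints using (count; g≗count; count-recurrence; count-initial)
open import Data.Nat using (ℕ; _≤_; _+_; _∸_)
open ≡-Reasoning

mainTheorem2 : (d : ℕ) → 1 ≤ d →
    (n : ℕ) → (g d ⊛ (oneMinusX ^S (d + 1))) n ≡ (onePlusX ^S (d ∸ 1)) n
mainTheorem2 d 1≤d n = begin
  (g d ⊛ (oneMinusX ^S (d + 1))) n       ≡⟨ ⊛-congʳ (g≗count d 1≤d) (oneMinusX ^S (d + 1)) n ⟩
  (count d ⊛ (oneMinusX ^S (d + 1))) n   ≡⟨ solve-recurrence count count-recurrence count-initial d 1≤d n ⟩
  (onePlusX ^S (d ∸ 1)) n                ∎
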